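{- Let $E$ and $F$ be finite sets and $\mathsf{A}$ a bimatroid on $E\times F$, with extended matroid $\widehat{\mathsf{A}}$ on $E\sqcup F$. The map $(S,T)\mapsto (E-S)\sqcup T$ induces a bijection between the set of vertical regular rectangles of $\mathsf{A}$ and the set of independent sets of $\widehat{\mathsf{A}}$.
   Context: A bimatroid $\mathsf{A}$ on $E\times F$ is a set $\mathcal{R}(\mathsf{A})$ of pairs $(I,J)$, $I\subseteq E$, $J\subseteq F$, $|I|=|J|$ (regular minors), such that $(\emptyset,\emptyset)\in\mathcal{R}(\mathsf{A})$ and for all $(I,J),(I',J')\in\mathcal{R}(\mathsf{A})$: (a) for every $i'\in I'-I$, either some $i\in I-I'$ has $((I-\{i\})\cup\{i'\},J)\in\mathcal{R}(\mathsf{A})$, or some $j'\in J'-J$ has $(I\cup\{i'\},J\cup\{j'\})\in\mathcal{R}(\mathsf{A})$; (b) for every $j\in J-J'$, either some $j'\in J'-J$ has $(I,(J-\{j\})\cup\{j'\})\in\mathcal{R}(\mathsf{A})$, or some $i\in I-I'$ has $(I-\{i\},J-\{j\})\in\mathcal{R}(\mathsf{A})$. The extended matroid $\widehat{\mathsf{A}}$ is the matroid on $E\sqcup F$ whose bases are the sets $(E-I)\sqcup J$ for $(I,J)\in\mathcal{R}(\mathsf{A})$. The relative rank $r_{\mathsf{A}}(S,T)$ ($S\subseteq E$, $T\subseteq F$) is the largest $d$ such that some $(I,J)\in\mathcal{R}(\mathsf{A})$ with $|I|=d$ has $I\subseteq S$, $J\subseteq T$. A pair $(S,T)$ is a vertical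 regular rectangle if $r_{\mathsf{A}}(S,T)=|T|\le|S|$. -}

module Defs where

open import Data.Nat using (ℕ; _≤_)
open import Data.Fin using (Fin)
open import Data.Fin.Subset using (Subset; _∈_; _∉_; _⊆_; ∁; _∪_; _-_; ⁅_⁆; ∣_∣; ⊥)
open import Data.Product using (Σ; ∃; ∃-syntax; _×_; _,_)
open import Data.Sum using (_⊎_)
open import Relation.Binary.PropositionalEquality using (_≡_)

-- E = Fin m, F = Fin n.  A subset of E ⊔ F is a pair (X , Y) : Subset m × Subset n.

MinorSet : ℕ → ℕ → Set₁
MinorSet m n = Subset m → Subset n → Set

record IsBimatroid {m n : ℕ} (R : MinorSet m n) : Set where
  field
    sameSize : ∀ I J → R I J → ∣ I ∣ ≡ ∣ J ∣
    empty    : R ⊥ ⊥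
    axiomA   : ∀ I J I′ J′ → R I J → R I′ J′ →
               ∀ i′ → i′ ∈ I′ → i′ ∉ I →
               (∃[ i ] (i ∈ I × i ∉ I′ × R ((I - i) ∪ ⁅ i′ ⁆) J))
               ⊎ (∃[ j′ ] (j′ ∈ J′ × j′ ∉ J × R (I ∪ ⁅ i′ ⁆) (J ∪ ⁅ j′ ⁆)))
    axiomB   : ∀ I J I′ J′ → R I J → R I′ J′ →
               ∀ j → j ∈ J → j ∉ J′ →
               (∃[ j′ ] (j′ ∈ J′ × j′ ∉ J × R I ((J - j) ∪ ⁅ j′ ⁆)))
               ⊎ (∃[ i ] (i ∈ I × i ∉ I′ × R (I - i) (J - j)))

record Bimatroid (m n : ℕ) : Set₁ where
  field
    Regular     : MinorSet m n
    isBimatroid : IsBimatroid Regular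
open Bimatroid public

IsRelRank : ∀ {m n} → Bimatroid m n → Subset m → Subset n → ℕ → Set
IsRelRank A S T d =
  (∃[ I ] ∃[ J ] (Regular A I J × I ⊆ S × J ⊆ T × ∣ I ∣ ≡ d))
  × (∀ I J → Regular A I J → I ⊆ S → J ⊆ T → ∣ I ∣ ≤ d)

VerticalRegularRectangle : ∀ {m n} → Bimatroid m n → Subset m → Subset n → Set
VerticalRegularRectangle A S T = IsRelRank A S T ∣ T ∣ × ∣ T ∣ ≤ ∣ S ∣

IsBaseExt : ∀ {m n} → Bimatroid m n → Subset m × Subset n → Set
IsBaseExt A (X , Y) = ∃[ I ] ∃[ J ] (Regular A I J × X ≡ ∁ I × Y ≡ J)

_⊆⊔_ : ∀ {m n} → Subset m × Subset n → Subset m × Subset n → Set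
(X , Y) ⊆⊔ (X′ , Y′) = X ⊆ X′ × Y ⊆ Y′

IsIndependentExt : ∀ {m n} → Bimatroid m n → Subset m × Subset n → Set
IsIndependentExt A Z = ∃[ B ] (IsBaseExt A B × Z ⊆⊔ B)

φ : ∀ {m n} → Subset m × Subset n → Subset m × Subset n
φ (S , T) = (∁ S , T)

-- A vertical regular rectangle (S,T) is exactly a pair admitting a regular
-- minor (I,T) with I ⊆ S: the rank witness (I,J) has J ⊆ T and |J| = |T|,
-- so J = T.  Hence φ (S,T) = (E - S) ⊔ T lies in the base (E - I) ⊔ T.
-- Conversely, an independent set (X,Y) lies in a base (E - I) ⊔ J, and by
-- axiom (b) applied against the empty minor, columns can be deleted one at a
-- time from a regular minor (each time deleting some row), giving a regular
-- minor (I′,Y) with I′ ⊆ I ⊆ E - X; so (E - X, Y) is a vertical rectangle.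
module Submission where

open import Defs
open import Data.Nat using (_≤_; _<_)
open import Data.Nat.Properties using (≤-trans; ≤-reflexive; <-irrefl)
open import Data.Nat.Induction using (<-wellFounded)
open import Induction.WellFounded using (Acc; acc)
open import Data.Fin.Subset using (Subset; _∈_; _∉_; _⊆_; _⊂_; ∁; _-_; ∣_∣; ⊥)
open import Data.Fin.Subset.Properties
  using (_∈?_; _⊂?_; ⊆-refl; ⊆-trans; ⊆-antisym; ∉⊥; p⊂q⇒∣p∣<∣q∣; p⊆q⇒∣p∣≤∣q∣;
         p⊆q⇒∁p⊇∁q; p─q⊆p; x∈p⇒∣p-x∣<∣p∣; x∈p∧x≢y⇒x∈p-y)
open import Data.Bool.Properties using (not-involutive)
open import Data.Vec using ([]; _∷_)
open import Data.Product using (∃-syntax; _×_; _,_; proj₁; proj₂)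
open import Data.Sum using (inj₁; inj₂)
open import Data.Empty using (⊥-elim)
open import Relation.Nullary using (yes; no; ¬_)
open import Relation.Binary.PropositionalEquality
  using (_≡_; refl; sym; trans; cong; cong₂; subst)

∁-involutive : ∀ {n} (p : Subset n) → ∁ (∁ p) ≡ p
∁-involutive []      = refl
∁-involutive (x ∷ p) = cong₂ _∷_ (not-involutive x) (∁-involutive p)

∁-injective : ∀ {n} {p q : Subset n} → ∁ p ≡ ∁ q → p ≡ q
∁-injective {p = p} {q} eq =
  trans (sym (∁-involutive p)) (trans (cong ∁ eq) (∁-involutive q))

p⊆∁q⇒q⊆∁p : ∀ {n} {p q : Subset n} → p ⊆ ∁ q → q ⊆ ∁ p
p⊆∁q⇒q⊆∁p {q = q} p⊆∁q =
  subst (_⊆ ∁ _) (∁-involutive q) (p⊆q⇒∁p⊇∁q p⊆∁q)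

p⊆q∧p⊄q⇒p≡q : ∀ {n} {p q : Subset n} → p ⊆ q → ¬ (p ⊂ q) → p ≡ q
p⊆q∧p⊄q⇒p≡q {p = p} {q} p⊆q p⊄q = ⊆-antisym p⊆q q⊆p
  where
  q⊆p : q ⊆ p
  q⊆p {x} x∈q with x ∈? p
  ... | yes x∈p = x∈p
  ... | no  x∉p = ⊥-elim (p⊄q (p⊆q , x , x∈q , x∉p))

p⊆q∧∣q∣≤∣p∣⇒p≡q : ∀ {n} {p q : Subset n} → p ⊆ q → ∣ q ∣ ≤ ∣ p ∣ → p ≡ q
p⊆q∧∣q∣≤∣p∣⇒p≡q p⊆q ∣q∣≤∣p∣ = p⊆q∧p⊄q⇒p≡q p⊆q
  (λ p⊂q → <-irrefl refl (≤-trans (p⊂q⇒∣p∣<∣q∣ p⊂q) ∣q∣≤∣p∣))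

x∉p∧p⊆q⇒p⊆q-x : ∀ {n} {p q : Subset n} {x} → x ∉ p → p ⊆ q → p ⊆ q - x
x∉p∧p⊆q⇒p⊆q-x x∉p p⊆q y∈p = x∈p∧x≢y⇒x∈p-y (p⊆q y∈p) (λ { refl → x∉p y∈p })

module _ {m n} (A : Bimatroid m n) where
  open IsBimatroid (isBimatroid A)

  regular-drop-column : ∀ {I J j} → Regular A I J → j ∈ J →
                        ∃[ i ] (i ∈ I × Regular A (I - i) (J - j))
  regular-drop-column {I} {J} {j} r j∈J with axiomB I J ⊥ ⊥ r empty j j∈J ∉⊥
  ... | inj₁ (_ , j′∈⊥ , _)    = ⊥-elim (∉⊥ j′∈⊥)
  ... | inj₂ (i , i∈I , _ , r′) = i , i∈I , r′

  regular-restrictʳ : ∀ {I J Y} → Regular A I J → Y ⊆ J →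
                      ∃[ I′ ] (I′ ⊆ I × Regular A I′ Y)
  regular-restrictʳ {J = J} = go (<-wellFounded ∣ J ∣)
    where
    go : ∀ {I J Y} → Acc _<_ ∣ J ∣ → Regular A I J → Y ⊆ J →
         ∃[ I′ ] (I′ ⊆ I × Regular A I′ Y)
    go {I} {J} {Y} (acc rec) r Y⊆J with Y ⊂? J
    ... | no Y⊄J = I , ⊆-refl , subst (Regular A I) (sym (p⊆q∧p⊄q⇒p≡q Y⊆J Y⊄J)) r
    ... | yes (_ , j , j∈J , j∉Y) with regular-drop-column r j∈J
    ...   | i , _ , r′ with go (rec (x∈p⇒∣p-x∣<∣p∣ j∈J)) r′ (x∉p∧p⊆q⇒p⊆q-x j∉Y Y⊆J)
    ...     | I′ , I′⊆I-i , r″ = I′ , ⊆-trans I′⊆I-i (p─q⊆p I _) , r″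

  regular-minor⇒vertical : ∀ {S I T} → I ⊆ S → Regular A I T →
                           VerticalRegularRectangle A S T
  regular-minor⇒vertical {S} {I} {T} I⊆S r =
    ((I , T , r , I⊆S , ⊆-refl , sameSize I T r) , maximal) ,
    ≤-trans (≤-reflexive (sym (sameSize I T r))) (p⊆q⇒∣p∣≤∣q∣ I⊆S)
    where
    maximal : ∀ I′ J′ → Regular A I′ J′ → I′ ⊆ S → J′ ⊆ T → ∣ I′ ∣ ≤ ∣ T ∣
    maximal I′ J′ r′ _ J′⊆T = ≤-trans (≤-reflexive (sameSize I′ J′ r′)) (p⊆q⇒∣p∣≤∣q∣ J′⊆T)

  vertical⇒regular-minor : ∀ {S T} → VerticalRegularRectangle A S T →
                           ∃[ I ] (I ⊆ S × Regular A I T)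
  vertical⇒regular-minor {T = T} (((I , J , r , I⊆S , J⊆T , ∣I∣≡∣T∣) , _) , _) =
    I , I⊆S , subst (Regular A I) J≡T r
    where
    J≡T : J ≡ T
    J≡T = p⊆q∧∣q∣≤∣p∣⇒p≡q J⊆T (≤-reflexive (trans (sym ∣I∣≡∣T∣) (sameSize I J r)))

proposition2p9 : ∀ {m n} (A : Bimatroid m n) →
    (∀ S T → VerticalRegularRectangle A S T → IsIndependentExt A (φ (S , T)))
    × (∀ S T S′ T′ → VerticalRegularRectangle A S T → VerticalRegularRectangle A S′ T′ →
         φ (S , T) ≡ φ (S′ , T′) → (S , T) ≡ (S′ , T′))
    × (∀ Z → IsIndependentExt A Z →
         ∃[ S ] ∃[ T ] (VerticalRegularRectangle A S T × φ (S , T) ≡ Z))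
proposition2p9 A = into , injective , onto
  where
  into : ∀ S T → VerticalRegularRectangle A S T → IsIndependentExt A (φ (S , T))
  into S T v with vertical⇒regular-minor A v
  ... | I , I⊆S , r = (∁ I , T) , (I , T , r , refl , refl) , p⊆q⇒∁p⊇∁q I⊆S , ⊆-refl

  injective : ∀ S T S′ T′ → VerticalRegularRectangle A S T → VerticalRegularRectangle A S′ T′ →
              φ (S , T) ≡ φ (S′ , T′) → (S , T) ≡ (S′ , T′)
  injective _ _ _ _ _ _ eq = cong₂ _,_ (∁-injective (cong proj₁ eq)) (cong proj₂ eq)

  onto : ∀ Z → IsIndependentExt A Z →
         ∃[ S ] ∃[ T ] (VerticalRegularRectangle A S T × φ (S , T) ≡ Z)
  onto (X , Y) (_ , (I , J , r , refl , refl) , X⊆∁I , Y⊆J) with regular-restrictʳ A r Y⊆J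
  ... | I′ , I′⊆I , r′ =
    ∁ X , Y , regular-minor⇒vertical A (⊆-trans I′⊆I (p⊆∁q⇒q⊆∁p X⊆∁I)) r′ ,
    cong (_, Y) (∁-involutive X)
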